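{- If $T$ is a rotational tournament on $n=2k+1$ vertices, then either $T$ is isomorphic to $U_{n}$, or $O(u)\cap O(v)\neq\emptyset$ for all distinct $u,v\in V(T)$.
   Context: Let $S$ be a set of $k$ integers in $\{1,\dots,2k\}$ such that $i+j\neq 2k+1$ for all $i,j\in S$. The rotational tournament with symbol $S$ has vertices $0,1,\dots,2k$ and an arc $i\rightarrow j$ iff $j-i \pmod{2k+1}\in S$ (this is a tournament). $U_n$ denotes the rotational tournament on $n=2k+1$ vertices with symbol $\{1,2,\dots,\frac{n-1}{2}\}$. $O(v)$ is the set of vertices that $v$ beats. -}

module Defs where

open import Data.Nat using (ℕ; suc; _+_; _*_; _∸_; _≤_; _<_)
open import Data.Nat.DivMod using (_%_)
open import Data.Fin using (Fin; toℕ)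
open import Data.List using (List; length; upTo; map)
open import Data.List.Membership.Propositional using (_∈_)
open import Data.List.Relation.Unary.Unique.Propositional using (Unique)
open import Data.Product using (_×_; Σ; ∃)
open import Relation.Binary.PropositionalEquality using (_≡_; _≢_)
open import Function.Bundles using (_⤖_; Bijection)

record IsSymbol (k : ℕ) (S : List ℕ) : Set where
  field
    unique   : Unique S
    size     : length S ≡ k
    inRange  : ∀ {i} → i ∈ S → 1 ≤ i × i ≤ 2 * k
    noOpp    : ∀ {i j} → i ∈ S → j ∈ S → i + j ≢ suc (2 * k)

Vertex : ℕ → Set
Vertex k = Fin (suc (2 * k))

diffMod : (k : ℕ) → Vertex k → Vertex k → ℕ
diffMod k i j = (toℕ j + (suc (2 * k) ∸ toℕ i)) % suc (2 * k)

Arc : (k : ℕ) → List ℕ → Vertex k → Vertex k → Set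
Arc k S i j = diffMod k i j ∈ S

USymbol : ℕ → List ℕ
USymbol k = map suc (upTo k)

Isomorphic : (k : ℕ) → List ℕ → List ℕ → Set
Isomorphic k S S′ =
  Σ (Vertex k ⤖ Vertex k) λ f →
    ∀ i j → (Arc k S i j → Arc k S′ (Bijection.to f i) (Bijection.to f j))
          × (Arc k S′ (Bijection.to f i) (Bijection.to f j) → Arc k S i j)

CommonOut : (k : ℕ) → List ℕ → Vertex k → Vertex k → Set
CommonOut k S u v = ∃ λ w → Arc k S u w × Arc k S v w

{-# OPTIONS --safe #-}
module Submission where

-- Let P ⊆ ℤ/n be the symbol, n = 2k + 1. Since |P| = k and P ∩ −P = ∅, P ⊔ −P = ℤ/n ∖ {0}.
-- If u ≠ v have no common out-neighbour, δ = v − u is a gap of P: x ∈ P ⇒ x + δ ∉ P.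
-- Replacing δ by −δ we may assume the gap d lies in P. Then s ∈ P and s + 2d ≠ 0 force
-- s + 2d ∈ P (s + d ∉ P, so −(s + d) ∈ P, so −(s + 2d) ∉ P). A walk from e ∈ P in steps
-- of 2d cannot reach e + (k + 1)·2d = e + d, so it hits 0 and e ∈ dℤ/n; applied to ±1
-- this makes d a unit. The walk from d then shows that P contains the k elements
-- d, 3d, …, (2k − 1)d, so P is exactly this set. Multiplication by (−2d)⁻¹ = d⁻¹k sends
-- (2j + 1)d to k − j, so it maps P onto {1, …, k}: an isomorphism onto U_n.

open import Defs
open import Algebra.Properties.CommutativeSemigroup using (x∙yz≈y∙xz)
open import Data.Empty using (⊥; ⊥-elim)
open import Data.Fin as Fin using (toℕ)
open import Data.Fin.Properties using (toℕ-fromℕ<; toℕ-injective; toℕ<n; all?; any?; ¬∀⟶∃¬)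
open import Data.List using (List; []; _∷_; length; map; upTo)
open import Data.List.Membership.Propositional using (_∈_)
open import Data.List.Membership.Propositional.Properties using (∈-map⁺; ∈-map⁻; ∈-upTo⁺; ∈-upTo⁻)
open import Data.List.Properties using (length-map; length-upTo; length-removeAt′)
open import Data.List.Relation.Binary.Subset.Propositional using (_⊆_)
open import Data.List.Relation.Unary.All as All using (All; _∷_)
import Data.List.Relation.Unary.All.Properties as All
open import Data.List.Relation.Unary.AllPairs using ([]; _∷_)
open import Data.List.Relation.Unary.Any using (here; there; _─_; index)
open import Data.List.Relation.Unary.Unique.Propositional using (Unique)
open import Data.Nat using (ℕ; zero; suc; _+_; _*_; _∸_; _≤_; _<_; _≟_; _≤?_; z≤n; s≤s)
open import Data.List.Membership.DecPropositional _≟_ using (_∈?_)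
open import Data.Nat.DivMod using (_%_; _mod_; m%n%n≡m%n; [m+kn]%n≡m%n; %-distribˡ-+; %-distribˡ-*; m<n⇒m%n≡m; m%n<n)
open import Data.Nat.Properties
open import Data.Nat.Tactic.RingSolver using (solve-∀)
open import Data.Product using (∃; ∃₂; _×_; _,_; proj₁; proj₂)
open import Data.Sum using (_⊎_; inj₁; inj₂; map₂)
open import Function using (_∘_; const; _⇔_; _⤖_; mk⇔; Equivalence; mk↔ₛ′)
open import Function.Properties.Equivalence using (⇔-setoid) renaming (sym to ⇔-sym)
open import Function.Properties.Inverse using (↔⇒⤖)
open import Level using (0ℓ)
open import Relation.Binary.Bundles using (Setoid)
open import Relation.Binary.Definitions using (Decidable)
open import Relation.Binary.PropositionalEquality using (_≡_; _≢_; refl; sym; trans; cong; cong₂; subst; module ≡-Reasoning)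
import Relation.Binary.Reasoning.Setoid as SetoidReasoning
open import Relation.Nullary using (¬_; Dec; yes; no; contradiction)
open import Relation.Nullary.Decidable using (map′; _×-dec_; _→-dec_; ¬?)

∈-─ : ∀ {A : Set} {x y : A} {ys} → x ∈ ys → x ≢ y → (y∈ys : y ∈ ys) → x ∈ (ys ─ y∈ys)
∈-─ (here refl)  x≢y (here refl)  = contradiction refl x≢y
∈-─ (here x≡z)   _   (there _)    = here x≡z
∈-─ (there x∈ys) _   (here _)     = x∈ys
∈-─ (there x∈ys) x≢y (there y∈ys) = there (∈-─ x∈ys x≢y y∈ys)

unique-⊆⇒length≤ : ∀ {A : Set} {xs ys : List A} → Unique xs → xs ⊆ ys → length xs ≤ length ys
unique-⊆⇒length≤ []                   _     = z≤n
unique-⊆⇒length≤ {xs = x ∷ xs} {ys} (x∉xs ∷ u) x∷xs⊆ys = begin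
  suc (length xs)             ≤⟨ s≤s (unique-⊆⇒length≤ u xs⊆ys─x) ⟩
  suc (length (ys ─ x∈ys))    ≡⟨ length-removeAt′ ys (index x∈ys) ⟨
  length ys                   ∎
  where
    open ≤-Reasoning
    x∈ys : x ∈ ys
    x∈ys = x∷xs⊆ys (here refl)
    xs⊆ys─x : xs ⊆ (ys ─ x∈ys)
    xs⊆ys─x y∈xs = ∈-─ (x∷xs⊆ys (there y∈xs)) (All.lookup x∉xs y∈xs ∘ sym) x∈ys

unique-map⁺ : ∀ {A B : Set} {f : A → B} {xs} →
              (∀ {x y} → x ∈ xs → y ∈ xs → f x ≡ f y → x ≡ y) → Unique xs → Unique (map f xs)
unique-map⁺ _   []           = []
unique-map⁺ inj (x∉xs ∷ u) =
  All.map⁺ (All.tabulate λ y∈xs fx≡fy → All.lookup x∉xs y∈xs (inj (here refl) (there y∈xs) fx≡fy))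
  ∷ unique-map⁺ (λ x∈ y∈ → inj (there x∈) (there y∈)) u

∈-USymbol⇔ : ∀ {k y} → y ∈ USymbol k ⇔ (1 ≤ y × y ≤ k)
∈-USymbol⇔ = mk⇔ to from
  where
    to : ∀ {k y} → y ∈ USymbol k → 1 ≤ y × y ≤ k
    to y∈ with ∈-map⁻ suc y∈
    ... | x , x∈upTo , refl = s≤s z≤n , ∈-upTo⁻ x∈upTo
    from : ∀ {k y} → 1 ≤ y × y ≤ k → y ∈ USymbol k
    from {y = suc _} (_ , y≤k) = ∈-map⁺ suc (∈-upTo⁺ y≤k)

length-USymbol : ∀ k → length (USymbol k) ≡ k
length-USymbol k = trans (length-map suc (upTo k)) (length-upTo k)

≤k⇒<1+2k : ∀ {k y} → y ≤ k → y < suc (2 * k)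
≤k⇒<1+2k y≤k = s≤s (≤-trans y≤k (m≤m+n _ _))

≰k⇒1+2k∸≤k : ∀ {k y} → ¬ y ≤ k → suc (2 * k) ∸ y ≤ k
≰k⇒1+2k∸≤k {k} y≰k =
  ≤-trans (∸-monoʳ-≤ (suc (2 * k)) (≰⇒> y≰k)) (≤-reflexive (trans (m+n∸m≡n k (k + 0)) (+-identityʳ k)))

module Residues (m : ℕ) where

  n : ℕ
  n = suc m

  infix 4 _≋_ _≉_ _≋?_
  -- A record rather than a bare equation, so that x and y can be inferred (_%_ is not injective).
  record _≋_ (x y : ℕ) : Set where
    constructor ≋-mod
    field ≋⇒%≡ : x % n ≡ y % n
  open _≋_ public

  _≉_ : ℕ → ℕ → Set
  x ≉ y = ¬ x ≋ y

  ≋-setoid : Setoid _ _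
  ≋-setoid = record
    { _≈_ = _≋_
    ; isEquivalence = record
      { refl  = ≋-mod refl
      ; sym   = λ (≋-mod p) → ≋-mod (sym p)
      ; trans = λ (≋-mod p) (≋-mod q) → ≋-mod (trans p q)
      }
    }

  module ≋-Reasoning = SetoidReasoning ≋-setoid
  open Setoid ≋-setoid public using ()
    renaming (refl to ≋-refl; sym to ≋-sym; trans to ≋-trans; reflexive to ≡⇒≋)

  _≋?_ : Decidable _≋_
  x ≋? y = map′ ≋-mod ≋⇒%≡ (x % n ≟ y % n)

  +-cong : ∀ {x x′ y y′} → x ≋ x′ → y ≋ y′ → x + y ≋ x′ + y′
  +-cong {x} {x′} {y} {y′} (≋-mod p) (≋-mod q) = ≋-mod (begin
    (x + y) % n              ≡⟨ %-distribˡ-+ x y n ⟩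
    (x % n + y % n) % n      ≡⟨ cong₂ (λ a b → (a + b) % n) p q ⟩
    (x′ % n + y′ % n) % n    ≡⟨ %-distribˡ-+ x′ y′ n ⟨
    (x′ + y′) % n            ∎)
    where open ≡-Reasoning

  *-cong : ∀ {x x′ y y′} → x ≋ x′ → y ≋ y′ → x * y ≋ x′ * y′
  *-cong {x} {x′} {y} {y′} (≋-mod p) (≋-mod q) = ≋-mod (begin
    (x * y) % n              ≡⟨ %-distribˡ-* x y n ⟩
    (x % n * (y % n)) % n    ≡⟨ cong₂ (λ a b → (a * b) % n) p q ⟩
    (x′ % n * (y′ % n)) % n  ≡⟨ %-distribˡ-* x′ y′ n ⟨
    (x′ * y′) % n            ∎)
    where open ≡-Reasoning

  *-congʳ : ∀ {x x′} y → x ≋ x′ → x * y ≋ x′ * y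
  *-congʳ y x≋x′ = *-cong x≋x′ (≋-refl {y})

  *-congˡ : ∀ x {y y′} → y ≋ y′ → x * y ≋ x * y′
  *-congˡ x = *-cong (≋-refl {x})

  +-congˡ : ∀ x {y y′} → y ≋ y′ → x + y ≋ x + y′
  +-congˡ x = +-cong (≋-refl {x})

  +-congʳ : ∀ {x x′} y → x ≋ x′ → x + y ≋ x′ + y
  +-congʳ y x≋x′ = +-cong x≋x′ (≋-refl {y})

  %-≋ : ∀ x → x % n ≋ x
  %-≋ x = ≋-mod (m%n%n≡m%n x n)

  ≡+multiple⇒≋ : ∀ {x y} c → x ≡ y + c * n → x ≋ y
  ≡+multiple⇒≋ {x} {y} c x≡y+cn = ≋-trans (≡⇒≋ x≡y+cn) (≋-mod ([m+kn]%n≡m%n y c n))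

  ≋⇒≡ : ∀ {x y} → x < n → y < n → x ≋ y → x ≡ y
  ≋⇒≡ {x} {y} x<n y<n (≋-mod eq) = begin
    x      ≡⟨ m<n⇒m%n≡m x<n ⟨
    x % n  ≡⟨ eq ⟩
    y % n  ≡⟨ m<n⇒m%n≡m y<n ⟩
    y      ∎
    where open ≡-Reasoning

  -- Negation modulo n is multiplication by n − 1 = m, which keeps everything in ℕ.
  infix 8 −_
  −_ : ℕ → ℕ
  − x = m * x

  +-inverseʳ : ∀ x → x + − x ≋ 0
  +-inverseʳ x = ≡+multiple⇒≋ x (sym (*-comm x n))

  +-inverseˡ-unique : ∀ {x y} → x + y ≋ 0 → x ≋ − y
  +-inverseˡ-unique {x} {y} x+y≋0 = begin
    x                ≡⟨ +-identityʳ x ⟨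
    x + 0            ≈⟨ +-congˡ x (+-inverseʳ y) ⟨
    x + (y + − y)    ≡⟨ +-assoc x y (− y) ⟨
    (x + y) + − y    ≈⟨ +-congʳ (− y) x+y≋0 ⟩
    − y              ∎
    where open ≋-Reasoning

  −-involutive : ∀ x → − − x ≋ x
  −-involutive x = ≋-sym (+-inverseˡ-unique (+-inverseʳ x))

  ∸-≋-− : ∀ {x} → x ≤ n → n ∸ x ≋ − x
  ∸-≋-− {x} x≤n = +-inverseˡ-unique (≡+multiple⇒≋ 1 (begin
    n ∸ x + x  ≡⟨ m∸n+n≡m x≤n ⟩
    n          ≡⟨ *-identityˡ n ⟨
    1 * n      ∎))
    where open ≡-Reasoning

  −-cong : ∀ {x y} → x ≋ y → − x ≋ − y
  −-cong = *-congˡ m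

  *-− : ∀ x y → x * − y ≡ − (x * y)
  *-− x y = x∙yz≈y∙xz *-commutativeSemigroup x m y

  invertible⇒≋0 : ∀ x⁻¹ x y → x⁻¹ * x ≋ 1 → x * y ≋ 0 → y ≋ 0
  invertible⇒≋0 x⁻¹ x y x⁻¹x≋1 xy≋0 = begin
    y                ≡⟨ *-identityˡ y ⟨
    1 * y            ≈⟨ *-congʳ y x⁻¹x≋1 ⟨
    x⁻¹ * x * y      ≡⟨ *-assoc x⁻¹ x y ⟩
    x⁻¹ * (x * y)    ≈⟨ *-congˡ x⁻¹ xy≋0 ⟩
    x⁻¹ * 0          ≡⟨ *-zeroʳ x⁻¹ ⟩
    0                ∎
    where open ≋-Reasoning

  record IsTournamentSymbol (P : ℕ → Set) : Set where
    field
      resp  : ∀ {x y} → x ≋ y → P x → P y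
      ¬P0   : ¬ P 0
      asym  : ∀ {x} → P x → ¬ P (− x)
      total : ∀ {x} → x ≉ 0 → P x ⊎ P (− x)

    ¬P⇒P− : ∀ {x} → x ≉ 0 → ¬ P x → P (− x)
    ¬P⇒P− x≉0 ¬Px with total x≉0
    ... | inj₁ Px  = contradiction Px ¬Px
    ... | inj₂ P−x = P−x

    ¬P−⇒P : ∀ {x} → x ≉ 0 → ¬ P (− x) → P x
    ¬P−⇒P x≉0 ¬P−x with total x≉0
    ... | inj₁ Px  = Px
    ... | inj₂ P−x = contradiction P−x ¬P−x

  Gap : (ℕ → Set) → ℕ → Set
  Gap P δ = ∀ x → P x → ¬ P (x + δ)

module GapArgument (k : ℕ) where
  open Residues (2 * k)

  record ScalesToInterval (P : ℕ → Set) : Set where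
    field
      a a⁻¹      : ℕ
      a*a⁻¹≋1    : a * a⁻¹ ≋ 1
      ∈⇔interval : ∀ x → P x ⇔ (1 ≤ (a * x) % n × (a * x) % n ≤ k)

  module _ {P : ℕ → Set} (isTS : IsTournamentSymbol P) where
    open IsTournamentSymbol isTS

    gap-− : ∀ {δ} → Gap P δ → Gap P (− δ)
    gap-− {δ} gap x Px P[x−δ] = gap (x + − δ) P[x−δ] (resp x≋x−δ+δ Px)
      where
        x≋x−δ+δ : x ≋ x + − δ + δ
        x≋x−δ+δ = begin
          x                ≡⟨ +-identityʳ x ⟨
          x + 0            ≈⟨ +-congˡ x (+-inverseʳ δ) ⟨
          x + (δ + − δ)    ≡⟨ cong (x +_) (+-comm δ (− δ)) ⟩
          x + (− δ + δ)    ≡⟨ +-assoc x (− δ) δ ⟨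
          x + − δ + δ      ∎
          where open ≋-Reasoning

    gap-in-symbol : ∀ {δ} → δ ≉ 0 → Gap P δ → ∃ λ d → P d × Gap P d
    gap-in-symbol {δ} δ≉0 gap with total δ≉0
    ... | inj₁ Pδ  = δ , Pδ , gap
    ... | inj₂ P−δ = − δ , P−δ , gap-− gap

    module _ {d : ℕ} (Pd : P d) (gap : Gap P d) where

      step : ∀ {s} → P s → s + (d + d) ≉ 0 → P (s + (d + d))
      step {s} Ps s+2d≉0 = ¬P−⇒P s+2d≉0 ¬P−[s+2d]
        where
          s+d≉0 : s + d ≉ 0
          s+d≉0 s+d≋0 = asym Pd (resp (+-inverseˡ-unique s+d≋0) Ps)

          P−[s+d] : P (− (s + d))
          P−[s+d] = ¬P⇒P− s+d≉0 (gap s Ps)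

          shift : ∀ k s d → 2 * k * (s + (d + d)) + d ≡ 2 * k * (s + d) + d * suc (2 * k)
          shift = solve-∀

          ¬P−[s+2d] : ¬ P (− (s + (d + d)))
          ¬P−[s+2d] P−[s+2d] = gap (− (s + (d + d))) P−[s+2d] (resp (≋-sym (≡+multiple⇒≋ d (shift k s d))) P−[s+d])

      climb : ∀ {e} → P e → ∀ t → P (e + t * (d + d)) ⊎ ∃ λ t → e + t * (d + d) ≋ 0
      climb {e} Pe zero = inj₁ (resp (≡⇒≋ (sym (+-identityʳ e))) Pe)
      climb {e} Pe (suc t) with climb Pe t | e + suc t * (d + d) ≋? 0
      ... | inj₂ hit       | _       = inj₂ hit
      ... | inj₁ _         | yes hit = inj₂ (suc t , hit)
      ... | inj₁ P[e+t2d]  | no ≉0   = inj₁ (resp (≡⇒≋ next) (step P[e+t2d] (≉0 ∘ ≋-trans (≡⇒≋ (sym next)))))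
        where
          next : e + t * (d + d) + (d + d) ≡ e + suc t * (d + d)
          next = trans (+-assoc e _ _) (cong (e +_) (+-comm (t * (d + d)) (d + d)))

      -- After k + 1 steps of 2d the walk would reach e + d, which the gap excludes.
      walk : ∀ {e} → P e → ∃ λ t → e + t * (d + d) ≋ 0
      walk {e} Pe with climb Pe (suc k)
      ... | inj₂ hit = hit
      ... | inj₁ P[e+[k+1]2d] = contradiction (resp (≡+multiple⇒≋ d (wrap k e d)) P[e+[k+1]2d]) (gap e Pe)
        where
          wrap : ∀ k e d → e + suc k * (d + d) ≡ e + d + d * suc (2 * k)
          wrap = solve-∀

      P⇒multiple : ∀ {e} → P e → ∃ λ c → d * c ≋ e
      P⇒multiple {e} Pe with walk Pe
      ... | t , e+t2d≋0 = − (t + t) , (begin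
        d * − (t + t)     ≡⟨ regroup k d t ⟩
        − (t * (d + d))   ≈⟨ +-inverseˡ-unique e+t2d≋0 ⟨
        e                 ∎)
        where
          open ≋-Reasoning
          regroup : ∀ k d t → d * (2 * k * (t + t)) ≡ 2 * k * (t * (d + d))
          regroup = solve-∀

      1≉0 : 1 ≉ 0
      1≉0 1≋0 = ¬P0 (resp d≋0 Pd)
        where
          d≋0 : d ≋ 0
          d≋0 = begin
            d       ≡⟨ *-identityʳ d ⟨
            d * 1   ≈⟨ *-congˡ d 1≋0 ⟩
            d * 0   ≡⟨ *-zeroʳ d ⟩
            0       ∎
            where open ≋-Reasoning

      d-invertible : ∃ λ c → d * c ≋ 1
      d-invertible with total 1≉0
      ... | inj₁ P1  = P⇒multiple P1
      ... | inj₂ P−1 with P⇒multiple P−1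
      ...   | c , dc≋−1 = − c , (begin
        d * − c     ≡⟨ *-− d c ⟩
        − (d * c)   ≈⟨ −-cong dc≋−1 ⟩
        − − 1       ≈⟨ −-involutive 1 ⟩
        1           ∎)
        where open ≋-Reasoning

      c : ℕ
      c = proj₁ d-invertible

      b a : ℕ
      b = − (d + d)
      a = c * k

      a*b≋1 : a * b ≋ 1
      a*b≋1 = begin
        c * k * − (d + d)   ≡⟨ regroup k c d ⟩
        d * c * − − 1       ≈⟨ *-cong (proj₂ d-invertible) (−-involutive 1) ⟩
        1                   ∎
        where
          open ≋-Reasoning
          regroup : ∀ k c d → c * k * (2 * k * (d + d)) ≡ d * c * (2 * k * (2 * k * 1))
          regroup = solve-∀

      b*a≋1 : b * a ≋ 1
      b*a≋1 = ≋-trans (≡⇒≋ (*-comm b a)) a*b≋1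

      b*k≋d : b * k ≋ d
      b*k≋d = begin
        − (d + d) * k   ≡⟨ regroup k d ⟩
        d * − − 1       ≈⟨ *-congˡ d (−-involutive 1) ⟩
        d * 1           ≡⟨ *-identityʳ d ⟩
        d               ∎
        where
          open ≋-Reasoning
          regroup : ∀ k d → 2 * k * (d + d) * k ≡ d * (2 * k * (2 * k * 1))
          regroup = solve-∀

      b*y≉0 : ∀ {y} → 1 ≤ y → y ≤ k → b * y ≉ 0
      b*y≉0 {y} 1≤y y≤k by≋0 = <⇒≢ 1≤y (sym (≋⇒≡ (≤k⇒<1+2k y≤k) (s≤s z≤n) (invertible⇒≋0 a b y a*b≋1 by≋0)))

      -- b * y ≋ (2(k − y) + 1) d: these are the odd multiples d, 3d, …, (2k − 1)d.
      P-b* : ∀ j {y} → j + y ≡ k → 1 ≤ y → P (b * y)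
      P-b* zero    refl _   = resp (≋-sym b*k≋d) Pd
      P-b* (suc j) {y} j+1+y≡k 1≤y =
        resp b[1+y]+2d≋by (step (P-b* j (trans (+-suc j y) j+1+y≡k) (s≤s z≤n)) (b*y≉0 1≤y y≤k ∘ ≋-trans (≋-sym b[1+y]+2d≋by)))
        where
          down : ∀ k d y → 2 * k * (d + d) * suc y + (d + d) ≡ 2 * k * (d + d) * y + (d + d) * suc (2 * k)
          down = solve-∀

          b[1+y]+2d≋by : b * suc y + (d + d) ≋ b * y
          b[1+y]+2d≋by = ≡+multiple⇒≋ (d + d) (down k d y)

          y≤k : y ≤ k
          y≤k = subst (y ≤_) j+1+y≡k (m≤n+m y (suc j))

      interval⇒P : ∀ {x y} → a * x ≋ y → 1 ≤ y → y ≤ k → P x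
      interval⇒P {x} {y} ax≋y 1≤y y≤k = resp by≋x (P-b* (k ∸ y) (m∸n+n≡m y≤k) 1≤y)
        where
          by≋x : b * y ≋ x
          by≋x = begin
            b * y         ≈⟨ *-congˡ b ax≋y ⟨
            b * (a * x)   ≡⟨ *-assoc b a x ⟨
            b * a * x     ≈⟨ *-congʳ x b*a≋1 ⟩
            1 * x         ≡⟨ *-identityˡ x ⟩
            x             ∎
            where open ≋-Reasoning

      P⇒interval : ∀ {x} → P x → 1 ≤ (a * x) % n × (a * x) % n ≤ k
      P⇒interval {x} Px = 1≤y , y≤k
        where
          y = (a * x) % n

          1≤y : 1 ≤ y
          1≤y = n≢0⇒n>0 λ y≡0 → ¬P0 (resp (invertible⇒≋0 b a x b*a≋1 (≋-mod y≡0)) Px)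

          a[−x]≋n∸y : a * − x ≋ n ∸ y
          a[−x]≋n∸y = begin
            a * − x     ≡⟨ *-− a x ⟩
            − (a * x)   ≈⟨ −-cong (%-≋ (a * x)) ⟨
            − y         ≈⟨ ∸-≋-− (<⇒≤ (m%n<n (a * x) n)) ⟨
            n ∸ y       ∎
            where open ≋-Reasoning

          y≤k : y ≤ k
          y≤k with y ≤? k
          ... | yes y≤k = y≤k
          ... | no  y≰k = contradiction
            (interval⇒P a[−x]≋n∸y (m<n⇒0<n∸m (m%n<n (a * x) n)) (≰k⇒1+2k∸≤k y≰k)) (asym Px)

      scalesToInterval : ScalesToInterval P
      scalesToInterval = record
        { a = a ; a⁻¹ = b ; a*a⁻¹≋1 = a*b≋1
        ; ∈⇔interval = λ x → mk⇔ P⇒interval (λ (1≤y , y≤k) → interval⇒P (≋-sym (%-≋ (a * x))) 1≤y y≤k)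
        }

    gap⇒scalesToInterval : ∀ {δ} → δ ≉ 0 → Gap P δ → ScalesToInterval P
    gap⇒scalesToInterval δ≉0 gap with gap-in-symbol δ≉0 gap
    ... | d , Pd , gap-d = scalesToInterval Pd gap-d

module Symbol (k : ℕ) where
  open Residues (2 * k)

  ∣_∣ₙ : ℕ → ℕ
  ∣ s ∣ₙ with s ≤? k
  ... | yes _ = s
  ... | no  _ = n ∸ s

  ∣∣ₙ-∈-USymbol : ∀ {s} → 1 ≤ s → s ≤ 2 * k → ∣ s ∣ₙ ∈ USymbol k
  ∣∣ₙ-∈-USymbol {s} 1≤s s≤2k with s ≤? k
  ... | yes s≤k = Equivalence.from ∈-USymbol⇔ (1≤s , s≤k)
  ... | no  s≰k = Equivalence.from ∈-USymbol⇔
    (m<n⇒0<n∸m (s≤s s≤2k) , ≰k⇒1+2k∸≤k s≰k)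

  ∣∣ₙ-injective : ∀ {s t} → s ≤ 2 * k → t ≤ 2 * k → ∣ s ∣ₙ ≡ ∣ t ∣ₙ → s ≡ t ⊎ s + t ≡ n
  ∣∣ₙ-injective {s} {t} s≤2k t≤2k eq with s ≤? k | t ≤? k
  ... | yes _ | yes _ = inj₁ eq
  ... | no  _ | no  _ = inj₁ (∸-cancelˡ-≡ (m≤n⇒m≤1+n s≤2k) (m≤n⇒m≤1+n t≤2k) eq)
  ... | yes _ | no  _ = inj₂ (trans (cong (_+ t) eq) (m∸n+n≡m (m≤n⇒m≤1+n t≤2k)))
  ... | no  _ | yes _ = inj₂ (trans (cong (s +_) (sym eq)) (m+[n∸m]≡n (m≤n⇒m≤1+n s≤2k)))

  infix 4 _∈ₙ_
  _∈ₙ_ : ℕ → List ℕ → Set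
  x ∈ₙ S = x % n ∈ S

  %-− : ∀ {x} → 1 ≤ x % n → (− x) % n ≡ n ∸ x % n
  %-− {x} 1≤r = begin
    (− x) % n              ≡⟨ ≋⇒%≡ (−-cong (%-≋ x)) ⟨
    (− (x % n)) % n        ≡⟨ ≋⇒%≡ (∸-≋-− (<⇒≤ (m%n<n x n))) ⟨
    (n ∸ x % n) % n        ≡⟨ m<n⇒m%n≡m (∸-monoʳ-< 1≤r (<⇒≤ (m%n<n x n))) ⟩
    n ∸ x % n              ∎
    where open ≡-Reasoning

  ∈ₙ-resp : ∀ {S x y} → x ≋ y → x ∈ₙ S → y ∈ₙ S
  ∈ₙ-resp {S} (≋-mod eq) = subst (_∈ S) eq

  module _ {S : List ℕ} (isSymbol : IsSymbol k S) where
    open IsSymbol isSymbol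

    -- If neither r nor n ∸ r is in S, ∣_∣ₙ maps the k + 1 elements of r ∷ S injectively into {1, …, k}.
    ∈-or-opposite∈ : ∀ {r} → 1 ≤ r → r ≤ 2 * k → r ∈ S ⊎ n ∸ r ∈ S
    ∈-or-opposite∈ {r} 1≤r r≤2k with r ∈? S | n ∸ r ∈? S
    ... | yes r∈S | _          = inj₁ r∈S
    ... | no  _   | yes r̄∈S   = inj₂ r̄∈S
    ... | no  r∉S | no  r̄∉S   = contradiction too-many (<-irrefl refl)
      where
        paired : ∀ {s} → s ∈ S → r ≡ s ⊎ r + s ≡ n → ⊥
        paired s∈S (inj₁ refl)  = r∉S s∈S
        paired {s} s∈S (inj₂ r+s≡n) = r̄∉S (subst (_∈ S) (sym (trans (cong (_∸ r) (sym r+s≡n)) (m+n∸m≡n r s))) s∈S)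

        ∣∣ₙ-injective-on : ∀ {x y} → x ∈ r ∷ S → y ∈ r ∷ S → ∣ x ∣ₙ ≡ ∣ y ∣ₙ → x ≡ y
        ∣∣ₙ-injective-on (here refl)  (here refl)  _  = refl
        ∣∣ₙ-injective-on (here refl)  (there y∈S) eq = ⊥-elim (paired y∈S (∣∣ₙ-injective r≤2k (proj₂ (inRange y∈S)) eq))
        ∣∣ₙ-injective-on (there x∈S) (here refl)  eq = ⊥-elim (paired x∈S (∣∣ₙ-injective r≤2k (proj₂ (inRange x∈S)) (sym eq)))
        ∣∣ₙ-injective-on (there x∈S) (there y∈S) eq with ∣∣ₙ-injective (proj₂ (inRange x∈S)) (proj₂ (inRange y∈S)) eq
        ... | inj₁ x≡y   = x≡y
        ... | inj₂ x+y≡n = contradiction x+y≡n (noOpp x∈S y∈S)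

        ∣r∷S∣ₙ⊆USymbol : map ∣_∣ₙ (r ∷ S) ⊆ USymbol k
        ∣r∷S∣ₙ⊆USymbol = All.lookup (All.map⁺ {xs = r ∷ S} (∣∣ₙ-∈-USymbol 1≤r r≤2k ∷ All.tabulate (λ s∈S → ∣∣ₙ-∈-USymbol (proj₁ (inRange s∈S)) (proj₂ (inRange s∈S)))))

        too-many : suc k ≤ k
        too-many = begin
          suc k                        ≡⟨ cong suc size ⟨
          length (r ∷ S)               ≡⟨ length-map ∣_∣ₙ (r ∷ S) ⟨
          length (map ∣_∣ₙ (r ∷ S))    ≤⟨ unique-⊆⇒length≤ (unique-map⁺ ∣∣ₙ-injective-on (All.tabulate (λ s∈S r≡s → r∉S (subst (_∈ S) (sym r≡s) s∈S)) ∷ unique)) ∣r∷S∣ₙ⊆USymbol ⟩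
          length (USymbol k)           ≡⟨ length-USymbol k ⟩
          k                            ∎
          where open ≤-Reasoning

    isTournamentSymbol : IsTournamentSymbol (_∈ₙ S)
    isTournamentSymbol = record
      { resp  = ∈ₙ-resp
      ; ¬P0   = λ 0∈S → contradiction (proj₁ (inRange 0∈S)) λ ()
      ; asym  = λ {x} x∈S −x∈S →
          noOpp x∈S (subst (_∈ S) (%-− (proj₁ (inRange x∈S))) −x∈S) (m+[n∸m]≡n (<⇒≤ (m%n<n x n)))
      ; total = total
      }
      where
        total : ∀ {x} → x ≉ 0 → x ∈ₙ S ⊎ − x ∈ₙ S
        total {x} x≉0 = map₂ (subst (_∈ S) (sym (%-− 1≤r))) (∈-or-opposite∈ 1≤r (≤-pred (m%n<n x n)))
          where 1≤r = n≢0⇒n>0 (x≉0 ∘ ≋-mod)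

module Rotational (k : ℕ) where
  open Residues (2 * k)
  open GapArgument k using (ScalesToInterval; gap⇒scalesToInterval)
  open Symbol k

  -- Arc k S i j unfolds to j ⊖ i ∈ₙ S.
  infixl 6 _⊖_
  _⊖_ : Vertex k → Vertex k → ℕ
  j ⊖ i = toℕ j + (n ∸ toℕ i)

  ⊖-≋ : ∀ i j → j ⊖ i ≋ toℕ j + − toℕ i
  ⊖-≋ i j = +-congˡ (toℕ j) (∸-≋-− (<⇒≤ (toℕ<n i)))

  ⊖≋0⇒≡ : ∀ {i j} → j ⊖ i ≋ 0 → i ≡ j
  ⊖≋0⇒≡ {i} {j} j⊖i≋0 = toℕ-injective (≋⇒≡ (toℕ<n i) (toℕ<n j) (begin
    toℕ i        ≈⟨ −-involutive (toℕ i) ⟨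
    − − toℕ i    ≈⟨ +-inverseˡ-unique (≋-trans (≋-sym (⊖-≋ i j)) j⊖i≋0) ⟨
    toℕ j        ∎))
    where open ≋-Reasoning

  toℕ-mod : ∀ x → toℕ (x mod n) ≋ x
  toℕ-mod x = ≋-trans (≡⇒≋ (toℕ-fromℕ< (m%n<n x n))) (%-≋ x)

  noCommonOut⇒gap : ∀ {S} u v → ¬ CommonOut k S u v → Gap (_∈ₙ S) (v ⊖ u)
  noCommonOut⇒gap {S} u v ¬common x x∈S x+v⊖u∈S =
    ¬common (w , ∈ₙ-resp (≋-sym w⊖u≋x+v⊖u) x+v⊖u∈S , ∈ₙ-resp (≋-sym w⊖v≋x) x∈S)
    where
      w : Vertex k
      w = (toℕ v + x) mod n

      shift : ∀ i → toℕ v + x + (n ∸ toℕ i) ≡ x + (v ⊖ i)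
      shift i = trans (cong (_+ (n ∸ toℕ i)) (+-comm (toℕ v) x)) (+-assoc x (toℕ v) (n ∸ toℕ i))

      w⊖u≋x+v⊖u : w ⊖ u ≋ x + (v ⊖ u)
      w⊖u≋x+v⊖u = ≋-trans (+-congʳ (n ∸ toℕ u) (toℕ-mod (toℕ v + x))) (≡⇒≋ (shift u))

      w⊖v≋x : w ⊖ v ≋ x
      w⊖v≋x = begin
        w ⊖ v                       ≈⟨ +-congʳ (n ∸ toℕ v) (toℕ-mod (toℕ v + x)) ⟩
        toℕ v + x + (n ∸ toℕ v)     ≡⟨ shift v ⟩
        x + (v ⊖ v)                 ≡⟨ cong (x +_) (m+[n∸m]≡n (<⇒≤ (toℕ<n v))) ⟩
        x + n                       ≈⟨ ≡+multiple⇒≋ 1 (cong (x +_) (sym (*-identityˡ n))) ⟩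
        x                           ∎
        where open ≋-Reasoning

  scale : ℕ → Vertex k → Vertex k
  scale a i = (a * toℕ i) mod n

  scale-inverse : ∀ a a⁻¹ → a * a⁻¹ ≋ 1 → ∀ i → scale a (scale a⁻¹ i) ≡ i
  scale-inverse a a⁻¹ aa⁻¹≋1 i = toℕ-injective (≋⇒≡ (toℕ<n _) (toℕ<n i) (begin
    toℕ (scale a (scale a⁻¹ i))   ≈⟨ toℕ-mod _ ⟩
    a * toℕ (scale a⁻¹ i)         ≈⟨ *-congˡ a (toℕ-mod _) ⟩
    a * (a⁻¹ * toℕ i)             ≡⟨ *-assoc a a⁻¹ (toℕ i) ⟨
    a * a⁻¹ * toℕ i               ≈⟨ *-congʳ (toℕ i) aa⁻¹≋1 ⟩
    1 * toℕ i                     ≡⟨ *-identityˡ (toℕ i) ⟩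
    toℕ i                         ∎))
    where open ≋-Reasoning

  scale-⊖ : ∀ a i j → scale a j ⊖ scale a i ≋ a * (j ⊖ i)
  scale-⊖ a i j = begin
    scale a j ⊖ scale a i                   ≈⟨ ⊖-≋ (scale a i) (scale a j) ⟩
    toℕ (scale a j) + − toℕ (scale a i)     ≈⟨ +-cong (toℕ-mod _) (−-cong (toℕ-mod _)) ⟩
    a * toℕ j + − (a * toℕ i)               ≡⟨ cong (a * toℕ j +_) (*-− a (toℕ i)) ⟨
    a * toℕ j + a * − toℕ i                 ≡⟨ *-distribˡ-+ a (toℕ j) (− toℕ i) ⟨
    a * (toℕ j + − toℕ i)                   ≈⟨ *-congˡ a (⊖-≋ i j) ⟨
    a * (j ⊖ i)                             ∎
    where open ≋-Reasoning

  scalesToInterval⇒isomorphic : ∀ {S} → ScalesToInterval (_∈ₙ S) → Isomorphic k S (USymbol k)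
  scalesToInterval⇒isomorphic {S} σ = bijection , λ i j → Equivalence.to (arc⇔ i j) , Equivalence.from (arc⇔ i j)
    where
      open ScalesToInterval σ

      InInterval : ℕ → Set
      InInterval y = 1 ≤ y × y ≤ k

      bijection : Vertex k ⤖ Vertex k
      bijection = ↔⇒⤖ (mk↔ₛ′ (scale a) (scale a⁻¹)
        (scale-inverse a a⁻¹ a*a⁻¹≋1) (scale-inverse a⁻¹ a (≋-trans (≡⇒≋ (*-comm a⁻¹ a)) a*a⁻¹≋1)))

      arc⇔ : ∀ i j → Arc k S i j ⇔ Arc k (USymbol k) (scale a i) (scale a j)
      arc⇔ i j = begin
        j ⊖ i ∈ₙ S                                ≈⟨ ∈⇔interval (j ⊖ i) ⟩
        InInterval ((a * (j ⊖ i)) % n)            ≡⟨ cong InInterval (≋⇒%≡ (scale-⊖ a i j)) ⟨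
        InInterval (diffMod k (scale a i) (scale a j)) ≈⟨ ⇔-sym ∈-USymbol⇔ ⟩
        diffMod k (scale a i) (scale a j) ∈ USymbol k  ∎
        where open SetoidReasoning (⇔-setoid 0ℓ)

  noCommonOut⇒isomorphic : ∀ {S u v} → IsSymbol k S → u ≢ v → ¬ CommonOut k S u v → Isomorphic k S (USymbol k)
  noCommonOut⇒isomorphic {u = u} {v} isSymbol u≢v ¬common = scalesToInterval⇒isomorphic
    (gap⇒scalesToInterval (isTournamentSymbol isSymbol) (u≢v ∘ ⊖≋0⇒≡) (noCommonOut⇒gap u v ¬common))

module _ (k : ℕ) (S : List ℕ) where

  commonOut? : ∀ u v → Dec (CommonOut k S u v)
  commonOut? u v = any? λ w → (diffMod k u w ∈? S) ×-dec (diffMod k v w ∈? S)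

  distinct⇒commonOut? : ∀ u v → Dec (u ≢ v → CommonOut k S u v)
  distinct⇒commonOut? u v = ¬? (u Fin.≟ v) →-dec commonOut? u v

  commonOut-or-counterexample :
    (∀ u v → u ≢ v → CommonOut k S u v) ⊎ ∃₂ λ u v → u ≢ v × ¬ CommonOut k S u v
  commonOut-or-counterexample with all? (λ u → all? (distinct⇒commonOut? u))
  ... | yes all = inj₁ all
  ... | no ¬all with ¬∀⟶∃¬ _ _ (λ u → all? (distinct⇒commonOut? u)) ¬all
  ...   | u , ¬all-u with ¬∀⟶∃¬ _ _ (distinct⇒commonOut? u) ¬all-u
  ...     | v , ¬pair = inj₂ (u , v , (λ u≡v → ¬pair λ u≢v → contradiction u≡v u≢v) , ¬pair ∘ const)

theorem18 : (k : ℕ) (S : List ℕ) → IsSymbol k S →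
    Isomorphic k S (USymbol k) ⊎ (∀ (u v : Vertex k) → u ≢ v → CommonOut k S u v)
theorem18 k S isSymbol with commonOut-or-counterexample k S
... | inj₁ common                  = inj₂ common
... | inj₂ (u , v , u≢v , ¬common) = inj₁ (noCommonOut⇒isomorphic isSymbol u≢v ¬common)
  where open Rotational k
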